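{- Let $p$ be a prime, $r\ge 2$ an integer, and let $f\colon\mathbb{Z}\to\mathbb{F}_p$ be the function determined by $f(k+r) = -f(k)-f(k+1)$ for all $k\in\mathbb{Z}$, together with $f(0)=1$ and $f(1)=\dots=f(r-1)=0$. Then for every $j\in\{0,\dots,r-2\}$ we have $f(jr+i)=0$ for all $i\in\{1,\dots,r-1-j\}$. -}

module Defs where

open import Data.Nat using (ℕ)
open import Data.Integer using (ℤ; +_; _-_)
open import Data.Integer.Divisibility using (_∣_)

-- The prime field 𝔽_p is modelled as ℤ modulo p (no quotient types in Agda):
-- an 𝔽_p-valued function is an ℤ-valued function, and equality in 𝔽_p is
-- congruence modulo p.
infix 4 _≡_[mod_]
_≡_[mod_] : ℤ → ℤ → ℕ → Set
a ≡ b [mod p ] = (+ p) ∣ (a - b)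

-- Zeros of f at k and k+1 force a zero at k+r, by the recurrence. Hence a
-- run of zeros at jr+1, …, jr+m shifts to a run at (j+1)r+1, …, (j+1)r+m-1,
-- one shorter; starting from the run 1, …, r-1 gives the claim.
module Submission where

open import Defs
open import Data.Nat using (ℕ; _≤_; _+_; _*_; zero; suc)
open import Data.Nat.Primality using (Prime)
open import Data.Integer using (ℤ; +_; -_) renaming (_+_ to _+ℤ_)
import Data.Integer as ℤ
import Data.Nat.Properties as ℕₚ
open import Data.Integer.Divisibility.Signed using (∣ᵤ⇒∣; ∣⇒∣ᵤ; ∣m∣n⇒∣m-n; ∣m∣n⇒∣m+n)
import Data.Integer.Divisibility.Signed as Signed
open import Data.Integer.Solver using (module +-*-Solver)
open import Relation.Binary.PropositionalEquality using (_≡_; refl; sym; trans; subst)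

≡0-by-neg-sum : ∀ {p} a x y → a ≡ (- x) +ℤ (- y) [mod p ] →
                x ≡ + 0 [mod p ] → y ≡ + 0 [mod p ] → a ≡ + 0 [mod p ]
≡0-by-neg-sum {p} a x y a≡ x≡0 y≡0 = ∣⇒∣ᵤ (subst (Signed._∣_ (+ p)) (sym split)
  (∣m∣n⇒∣m-n (∣ᵤ⇒∣ {i = a ℤ.- ((- x) +ℤ (- y))} a≡)
             (∣m∣n⇒∣m+n (∣ᵤ⇒∣ {i = x ℤ.- + 0} x≡0) (∣ᵤ⇒∣ {i = y ℤ.- + 0} y≡0))))
  where
  open +-*-Solver
  split : a ℤ.- + 0 ≡ (a ℤ.- ((- x) +ℤ (- y))) ℤ.- ((x ℤ.- + 0) +ℤ (y ℤ.- + 0))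
  split = solve 3 (λ a x y → a :- con (+ 0)
                         := (a :- ((:- x) :+ (:- y))) :- ((x :- con (+ 0)) :+ (y :- con (+ 0))))
                  refl a x y

module Recurrence (p r : ℕ) (f : ℤ → ℤ)
  (rec : ∀ k → f (k +ℤ + r) ≡ (- f k) +ℤ (- f (k +ℤ + 1)) [mod p ]) where

  Vanishes : ℕ → Set
  Vanishes n = f (+ n) ≡ + 0 [mod p ]

  vanishes-+r : ∀ n → Vanishes n → Vanishes (n + 1) → Vanishes (n + r)
  vanishes-+r n = ≡0-by-neg-sum (f (+ (n + r))) (f (+ n)) (f (+ (n + 1))) (rec (+ n))

  vanishes-block : (∀ i → 1 ≤ i → i + 1 ≤ r → Vanishes i) →
                   ∀ j i → 1 ≤ i → i + j + 1 ≤ r → Vanishes (j * r + i)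
  vanishes-block base zero    i 1≤i i+1≤r =
    base i 1≤i (subst (λ t → t + 1 ≤ r) (ℕₚ.+-identityʳ i) i+1≤r)
  vanishes-block base (suc j) i 1≤i i+j+2≤r =
    subst Vanishes shift (vanishes-+r (j * r + i) at-i at-i+1)
    where
    at-i : Vanishes (j * r + i)
    at-i = vanishes-block base j i 1≤i
             (ℕₚ.≤-trans (ℕₚ.+-monoˡ-≤ 1 (ℕₚ.+-monoʳ-≤ i (ℕₚ.n≤1+n j))) i+j+2≤r)
    at-i+1 : Vanishes (j * r + i + 1)
    at-i+1 = subst Vanishes (sym (ℕₚ.+-assoc (j * r) i 1))
               (vanishes-block base j (i + 1) (ℕₚ.m≤n+m 1 i)
                 (subst (λ t → t + 1 ≤ r) (sym (ℕₚ.+-assoc i 1 j)) i+j+2≤r))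
    shift : j * r + i + r ≡ suc j * r + i
    shift = trans (ℕₚ.+-comm (j * r + i) r) (sym (ℕₚ.+-assoc r (j * r) i))

lemma3p5 : (p : ℕ) → Prime p → (r : ℕ) → 2 ≤ r →
           (f : ℤ → ℤ) →
           (∀ (k : ℤ) → f (k +ℤ + r) ≡ (- f k) +ℤ (- f (k +ℤ + 1)) [mod p ]) →
           f (+ 0) ≡ + 1 [mod p ] →
           (∀ (i : ℕ) → 1 ≤ i → i + 1 ≤ r → f (+ i) ≡ + 0 [mod p ]) →
           ∀ (j : ℕ) → j + 2 ≤ r →
           ∀ (i : ℕ) → 1 ≤ i → i + j + 1 ≤ r →
           f (+ (j * r + i)) ≡ + 0 [mod p ]
lemma3p5 p _ r _ f rec _ base j _ = Recurrence.vanishes-block p r f rec base j
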